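{- Let $G$ be a finite, simple, connected, non-trivial graph which is not a path. For each natural number $d$ with $d\le\sigma^\square_V(G)$, it holds that $\mathrm{cap}^\square_d(G)\ge\mathrm{cap}^\square(G)\ge 2$.
   Context: Graphs are finite, simple, undirected and connected; $d_G$ denotes shortest-path distance. For an integer $\ell\ge 0$, a weak walk of length $\ell$ on $G$ is a function $f:\{0,\dots,\ell\}\to V(G)$ with $f(i)=f(i+1)$ or $f(i)f(i+1)\in E(G)$ for all $0\le i<\ell$; a weak $\ell$-track is a surjective one. For $f,g:\{0,\dots,\ell\}\to V(G)$, $m_G(f,g)=\min_i d_G(f(i),g(i))$; for a family $F=\{f_1,\dots,f_p\}$ with $p\ge2$, $m_G(F)=\min_{i\ne j}m_G(f_i,f_j)$, and $m_G(F)=\infty$ if $p=1$. A family $F=\{f_1,\dots,f_p\}$ of weak walks of length $\ell$ is patient if for each $i\in\{0,\dots,\ell-1\}$ there is $j$ with $f_j(i)f_j(i+1)\in E(G)$ and $f_{j'}(i)=f_{j'}(i+1)$ for all $j'\ne j$; a patient $\ell$-tour is a patient family in which every member is a weak $\ell$-track. The Cartesian vertex span is $\sigma^\square_V(G)=\max\{m_G(f,g):\ell\ge0,\ \{f,g\}\text{ a patient }\ell\text{ -tour}\}$. For natural $d\le\sigma^\square_V(G)$, $\mathrm{cap}^\square_d(G)$ is the maximum $c$ such that there is a patient $\ell$-tour $F=\{f_1,\dots,f_c\}$ (some $\ell$) with $m_G(F)=d$, and $\mathrm{cap}^\square(G)=\mathrm{cap}^\square_{\sigma^\square_V(G)}(G)$.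 -}

module Defs where

open import Data.Nat using (ℕ; zero; suc; _+_; _≤_; _<_)
open import Data.Fin using (Fin; toℕ; inject₁) renaming (zero to fzero; suc to fsuc)
open import Data.Product using (Σ; ∃; _×_; _,_)
open import Data.Sum using (_⊎_)
open import Relation.Nullary using (¬_)
open import Relation.Binary.PropositionalEquality using (_≡_; _≢_)

record Graph : Set₁ where
  field
    n     : ℕ
    E     : Fin n → Fin n → Set
    sym   : ∀ {u v} → E u v → E v u
    irrefl : ∀ {u} → ¬ E u u

module _ (G : Graph) where
  open Graph G

  V : Set
  V = Fin n

  -- walks with exactly k edges from u to v
  data PathLen : V → V → ℕ → Set where
    here : ∀ {u} → PathLen u u 0
    step : ∀ {u w v k} → E u w → PathLen w v k → PathLen u v (suc k)

  Dist : V → V → ℕ → Set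
  Dist u v k = PathLen u v k × (∀ j → j < k → ¬ PathLen u v j)

  Connected : Set
  Connected = ∀ u v → ∃ λ k → PathLen u v k

  NonTrivial : Set
  NonTrivial = 2 ≤ n

  -- G is isomorphic to the path P_n (vertices 0,...,n-1, i ~ i+1)
  IsPathGraph : Set
  IsPathGraph = Σ (V → V) λ π → Σ (V → V) λ π⁻ →
    (∀ v → π⁻ (π v) ≡ v) × (∀ v → π (π⁻ v) ≡ v) ×
    (∀ u v → (E u v → (suc (toℕ (π u)) ≡ toℕ (π v) ⊎ suc (toℕ (π v)) ≡ toℕ (π u)))
           × ((suc (toℕ (π u)) ≡ toℕ (π v) ⊎ suc (toℕ (π v)) ≡ toℕ (π u)) → E u v))

  Fun : ℕ → Set
  Fun ℓ = Fin (suc ℓ) → V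

  WeakWalk : ∀ {ℓ} → Fun ℓ → Set
  WeakWalk {ℓ} f = ∀ (i : Fin ℓ) → f (inject₁ i) ≡ f (fsuc i) ⊎ E (f (inject₁ i)) (f (fsuc i))

  WeakTrack : ∀ {ℓ} → Fun ℓ → Set
  WeakTrack f = WeakWalk f × (∀ v → ∃ λ t → f t ≡ v)

  Family : ℕ → ℕ → Set
  Family c ℓ = Fin c → Fun ℓ

  -- the members are pairwise distinct functions (the family is a set)
  DistinctMembers : ∀ {c ℓ} → Family c ℓ → Set
  DistinctMembers {c} F = ∀ (i j : Fin c) → i ≢ j → ∃ λ t → F i t ≢ F j t

  Patient : ∀ {c ℓ} → Family c ℓ → Set
  Patient {c} {ℓ} F = (∀ j → WeakWalk (F j)) ×
    (∀ (i : Fin ℓ) → ∃ λ (j : Fin c) → E (F j (inject₁ i)) (F j (fsuc i)) ×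
        (∀ j' → j' ≢ j → F j' (inject₁ i) ≡ F j' (fsuc i)))

  PatientTour : ∀ {c ℓ} → Family c ℓ → Set
  PatientTour F = Patient F × (∀ j → WeakTrack (F j))

  MinDistPair : ∀ {ℓ} → Fun ℓ → Fun ℓ → ℕ → Set
  MinDistPair f g d = (∀ t k → Dist (f t) (g t) k → d ≤ k) × (∃ λ t → Dist (f t) (g t) d)

  -- m_G(F) = d (finite value; for c = 1, m_G(F) = ∞ so c ≥ 2 is required)
  MinDist : ∀ {c ℓ} → Family c ℓ → ℕ → Set
  MinDist {c} F d = 2 ≤ c ×
    (∀ i j → i ≢ j → ∀ t k → Dist (F i t) (F j t) k → d ≤ k) ×
    (Σ (Fin c) λ i → Σ (Fin c) λ j → i ≢ j × ∃ λ t → Dist (F i t) (F j t) d)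

  SpanAchieved : ℕ → Set
  SpanAchieved s = ∃ λ ℓ → Σ (Family 2 ℓ) λ F →
    PatientTour F × MinDistPair (F fzero) (F (fsuc fzero)) s

  IsVertexSpan : ℕ → Set
  IsVertexSpan s = SpanAchieved s × (∀ s' → SpanAchieved s' → s' ≤ s)

  CapAchieved : ℕ → ℕ → Set
  CapAchieved d c = ∃ λ ℓ → Σ (Family c ℓ) λ F →
    DistinctMembers F × PatientTour F × MinDist F d

  IsCap : ℕ → ℕ → Set
  IsCap d c = CapAchieved d c × (∀ c' → CapAchieved d c' → c' ≤ c)

{-# OPTIONS --safe #-}

-- Take a patient tour F of c = cap(G) members realising m_G(F) = s = σ(G), two members i, j
-- at distance s at some time t₀, and a shortest walk P from i to j at that time.  Run F
-- forward, then backward to t₀, then let i walk s − d steps along P while everybody else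
-- waits.  Every new track contains the old one, so this is again a patient tour of c distinct
-- members.  By the triangle inequality through P, after m steps i is at distance at least
-- s − m ≥ d from every other member, and at the end it is at distance exactly d from j.
-- Hence cap_d(G) ≥ c.  Connectivity, non-triviality and G not being a path only serve to make
-- σ(G) and cap(G) exist; here they are given.
module Submission where

open import Defs
open import Data.Nat using (ℕ; _≤_)
open import Data.Product using (Σ; _×_)
open import Relation.Nullary using (¬_)

open import Data.Nat using (zero; suc; _+_; _∸_; _<_; z≤n; s≤s; _≤?_)
open import Data.Nat.Properties
  using (≤-refl; ≤-trans; <-trans; <⇒≤; <⇒≱; ≰⇒>; m≤m+n; m∸n≤m; m≤n+o⇒m∸n≤o;
         ∸-monoʳ-≤; +-∸-assoc; m∸[m∸n]≡n)
open import Data.Nat.Induction using (<-rec)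
open import Data.Fin using (Fin; toℕ; inject₁; fromℕ; fromℕ<; _≟_)
  renaming (zero to fzero; suc to fsuc)
open import Data.Fin.Properties
  using (toℕ-injective; toℕ-inject₁; toℕ-fromℕ; toℕ-fromℕ<; toℕ<n; toℕ≤pred[n])
open import Data.Vec.Functional using (Vector; updateAt)
open import Data.Vec.Functional.Properties
  using (updateAt-updates; updateAt-minimal; updateAt-id-local)
open import Data.Product using (_,_; proj₁; proj₂)
open import Data.Sum using (inj₁; inj₂)
open import Data.Empty using (⊥-elim)
open import Function using (_∘_; const)
open import Relation.Nullary using (yes; no)
open import Relation.Binary.PropositionalEquality
  using (_≡_; _≢_; _≗_; refl; sym; trans; cong; subst; subst₂; module ≡-Reasoning)

clamp : (ℓ : ℕ) → ℕ → Fin (suc ℓ)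
clamp ℓ       zero    = fzero
clamp zero    (suc n) = fzero
clamp (suc ℓ) (suc n) = fsuc (clamp ℓ n)

toℕ-clamp : ∀ ℓ {n} → n ≤ ℓ → toℕ (clamp ℓ n) ≡ n
toℕ-clamp ℓ       {zero}  _       = refl
toℕ-clamp (suc ℓ) {suc n} (s≤s p) = cong suc (toℕ-clamp ℓ p)

clamp-toℕ : ∀ ℓ (t : Fin (suc ℓ)) → clamp ℓ (toℕ t) ≡ t
clamp-toℕ ℓ t = toℕ-injective (toℕ-clamp ℓ (toℕ≤pred[n] t))

module _ (G : Graph) where
  open Graph G using (E) renaming (sym to E-sym)

  vertex : ∀ {u v k} → PathLen G u v k → ℕ → V G
  vertex {u} _          zero    = u
  vertex {u} here       (suc _) = u
  vertex     (step _ p) (suc m) = vertex p m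

  prefix : ∀ {u v k} (p : PathLen G u v k) m → m ≤ k → PathLen G u (vertex p m) m
  prefix p          zero    _       = here
  prefix (step e p) (suc m) (s≤s q) = step e (prefix p m q)

  suffix : ∀ {u v k} (p : PathLen G u v k) m → m ≤ k → PathLen G (vertex p m) v (k ∸ m)
  suffix p          zero    _       = p
  suffix (step _ p) (suc m) (s≤s q) = suffix p m q

  vertex-edge : ∀ {u v k} (p : PathLen G u v k) m → m < k → E (vertex p m) (vertex p (suc m))
  vertex-edge (step e _) zero    _       = e
  vertex-edge (step _ p) (suc m) (s≤s q) = vertex-edge p m q

  _++ʷ_ : ∀ {a b c x y} → PathLen G a b x → PathLen G b c y → PathLen G a c (x + y)
  here     ++ʷ q = q
  step e p ++ʷ q = step e (p ++ʷ q)

  snocʷ : ∀ {a b c x} → PathLen G a b x → E b c → PathLen G a c (suc x)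
  snocʷ here       e = step e here
  snocʷ (step e p) f = step e (snocʷ p f)

  reverseʷ : ∀ {a b x} → PathLen G a b x → PathLen G b a x
  reverseʷ here       = here
  reverseʷ (step e p) = snocʷ (reverseʷ p) (E-sym e)

  castʷ : ∀ {u u' w w' L} → u ≡ u' → w ≡ w' → PathLen G u w L → PathLen G u' w' L
  castʷ refl refl q = q

  -- A walk shorter than s of minimal length would realise a distance below s.
  distBound⇒walkBound : ∀ {u v s} → (∀ k → Dist G u v k → s ≤ k) →
                        ∀ {L} → PathLen G u v L → s ≤ L
  distBound⇒walkBound {u} {v} {s} distBound {L} = <-rec (λ L → PathLen G u v L → s ≤ L) bound L
    where
    bound : ∀ L → (∀ {j} → j < L → PathLen G u v j → s ≤ j) → PathLen G u v L → s ≤ L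
    bound L shorter p with s ≤? L
    ... | yes s≤L = s≤L
    ... | no s≰L  = distBound L (p , λ j j<L q → <⇒≱ (<-trans j<L (≰⇒> s≰L)) (shorter j<L q))

  Config : ℕ → Set
  Config = Vector (V G)

  Move : ∀ {c} → Config c → Config c → Set
  Move {c} x y = Σ (Fin c) λ j → E (x j) (y j) × (∀ j' → j' ≢ j → x j' ≡ y j')

  Move-resp-≗ : ∀ {c} {x x' y y' : Config c} → x ≗ x' → y ≗ y' → Move x y → Move x' y'
  Move-resp-≗ x≗x' y≗y' (j , e , rest) =
    j , subst₂ E (x≗x' j) (y≗y' j) e
      , λ j' j'≢j → trans (sym (x≗x' j')) (trans (rest j' j'≢j) (y≗y' j'))

  Move-sym : ∀ {c} {x y : Config c} → Move x y → Move y x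
  Move-sym (j , e , rest) = j , E-sym e , λ j' j'≢j → sym (rest j' j'≢j)

  Run : ∀ {c} → (ℕ → Config c) → ℕ → Set
  Run h L = ∀ m → m < L → Move (h m) (h (suc m))

  Run-≤ : ∀ {c} {h : ℕ → Config c} {r L} → r ≤ L → Run h L → Run h r
  Run-≤ r≤L run m m<r = run m (≤-trans m<r r≤L)

  Run-reverse : ∀ {c} {h : ℕ → Config c} L → Run h L → Run (λ n → h (L ∸ n)) L
  Run-reverse {h = h} L run m m<L =
    Move-resp-≗ (λ k → cong (λ n → h n k) (sym L∸m≡1+L∸1+m)) (λ _ → refl)
                (Move-sym (run (L ∸ suc m) L∸1+m<L))
    where
    L∸m≡1+L∸1+m : L ∸ m ≡ suc (L ∸ suc m)
    L∸m≡1+L∸1+m = +-∸-assoc 1 m<L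
    L∸1+m<L : L ∸ suc m < L
    L∸1+m<L = subst (_≤ L) L∸m≡1+L∸1+m (m∸n≤m L m)

  -- Index a is read from h₁ and h₂ 0 is skipped: the two runs are glued at a shared configuration.
  _⟨_⟩++_ : ∀ {c} → (ℕ → Config c) → ℕ → (ℕ → Config c) → ℕ → Config c
  (h₁ ⟨ _     ⟩++ _ ) zero    = h₁ zero
  (_  ⟨ zero  ⟩++ h₂) (suc n) = h₂ (suc n)
  (h₁ ⟨ suc a ⟩++ h₂) (suc n) = ((h₁ ∘ suc) ⟨ a ⟩++ h₂) n

  module _ {c : ℕ} where

    Run-++ : ∀ a b {h₁ h₂ : ℕ → Config c} → Run h₁ a → Run h₂ b → h₁ a ≗ h₂ 0 →
             Run (h₁ ⟨ a ⟩++ h₂) (a + b)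
    Run-++ zero    b run₁ run₂ join zero    m<b       =
      Move-resp-≗ (sym ∘ join) (λ _ → refl) (run₂ zero m<b)
    Run-++ zero    b run₁ run₂ join (suc m) m<b       = run₂ (suc m) m<b
    Run-++ (suc a) b run₁ run₂ join zero    _         = run₁ zero (s≤s z≤n)
    Run-++ (suc a) b run₁ run₂ join (suc m) (s≤s m<n) =
      Run-++ a b (λ m' m'<a → run₁ (suc m') (s≤s m'<a)) run₂ join m m<n

    ++-all : ∀ (P : Config c → Set) a b {h₁ h₂ : ℕ → Config c} →
             (∀ n → n ≤ a → P (h₁ n)) → (∀ n → n ≤ b → P (h₂ n)) →
             ∀ n → n ≤ a + b → P ((h₁ ⟨ a ⟩++ h₂) n)
    ++-all P a       b all₁ all₂ zero    _         = all₁ zero z≤n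
    ++-all P zero    b all₁ all₂ (suc n) n≤b       = all₂ (suc n) n≤b
    ++-all P (suc a) b all₁ all₂ (suc n) (s≤s n≤n') =
      ++-all P a b (λ n' n'≤a → all₁ (suc n') (s≤s n'≤a)) all₂ n n≤n'

    ++-prefix : ∀ a {h₁ h₂ : ℕ → Config c} n → n ≤ a → (h₁ ⟨ a ⟩++ h₂) n ≡ h₁ n
    ++-prefix a       zero    _       = refl
    ++-prefix (suc a) (suc n) (s≤s p) = ++-prefix a n p

    ++-end : ∀ a b {h₁ h₂ : ℕ → Config c} → h₁ a ≗ h₂ 0 → (h₁ ⟨ a ⟩++ h₂) (a + b) ≗ h₂ b
    ++-end zero    zero    join = join
    ++-end zero    (suc b) join = λ _ → refl
    ++-end (suc a) b       join = ++-end a b join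

    Separated : ℕ → Config c → Set
    Separated d x = ∀ a b → a ≢ b → ∀ {L} → PathLen G (x a) (x b) L → d ≤ L

    Separated-mono : ∀ {d d' x} → d ≤ d' → Separated d' x → Separated d x
    Separated-mono d≤d' sep a b a≢b p = ≤-trans d≤d' (sep a b a≢b p)

    module _ (x : Config c) (i : Fin c) {v : V G} {k : ℕ} (p : PathLen G (x i) v k) where

      slide : ℕ → Config c
      slide m = updateAt x i (const (vertex p m))

      slide-moves : ∀ m → slide m i ≡ vertex p m
      slide-moves m = updateAt-updates i x

      slide-stays : ∀ m {j} → j ≢ i → slide m j ≡ x j
      slide-stays m {j} j≢i = updateAt-minimal j i x j≢i

      slide-zero : slide 0 ≗ x
      slide-zero = updateAt-id-local i x refl

      slide-run : Run slide k
      slide-run m m<k =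
        i , subst₂ E (sym (slide-moves m)) (sym (slide-moves (suc m))) (vertex-edge p m m<k)
          , λ j j≢i → trans (slide-stays m j≢i) (sym (slide-stays (suc m) j≢i))

      moved-bound : ∀ {s m} → m ≤ k → Separated s x →
                    ∀ b → b ≢ i → ∀ {L} → PathLen G (vertex p m) (x b) L → s ∸ m ≤ L
      moved-bound {s} {m} m≤k sep b b≢i q =
        m≤n+o⇒m∸n≤o s m (sep i b (b≢i ∘ sym) (prefix p m m≤k ++ʷ q))

      slide-separated : ∀ {s m} → m ≤ k → Separated s x → Separated (s ∸ m) (slide m)
      slide-separated {s} {m} m≤k sep a b a≢b q with a ≟ i | b ≟ i
      ... | yes refl | yes refl = ⊥-elim (a≢b refl)
      ... | yes refl | no b≢i   =
        moved-bound m≤k sep b b≢i (castʷ (slide-moves m) (slide-stays m b≢i) q)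
      ... | no a≢i   | yes refl =
        moved-bound m≤k sep a a≢i (reverseʷ (castʷ (slide-stays m a≢i) (slide-moves m) q))
      ... | no a≢i   | no b≢i   =
        ≤-trans (m∸n≤m s m) (sep a b a≢b (castʷ (slide-stays m a≢i) (slide-stays m b≢i) q))

  snapshot : ∀ {c ℓ} → Family G c ℓ → ℕ → Config c
  snapshot {ℓ = ℓ} F n k = F k (clamp ℓ n)

  family : ∀ {c} L → (ℕ → Config c) → Family G c L
  family L H k t = H (toℕ t) k

  Patient⇒Run : ∀ {c ℓ} (F : Family G c ℓ) → Patient G F → Run (snapshot F) ℓ
  Patient⇒Run {ℓ = ℓ} F (_ , moves) m m<ℓ =
    Move-resp-≗ (λ k → cong (F k) (sym clamp-m)) (λ k → cong (F k) (sym clamp-1+m)) (moves i)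
    where
    i : Fin ℓ
    i = fromℕ< m<ℓ
    clamp-m : clamp ℓ m ≡ inject₁ i
    clamp-m = toℕ-injective
      (trans (toℕ-clamp ℓ (<⇒≤ m<ℓ)) (sym (trans (toℕ-inject₁ i) (toℕ-fromℕ< m<ℓ))))
    clamp-1+m : clamp ℓ (suc m) ≡ fsuc i
    clamp-1+m = toℕ-injective (trans (toℕ-clamp ℓ m<ℓ) (cong suc (sym (toℕ-fromℕ< m<ℓ))))

  Run⇒Patient : ∀ {c} L {H : ℕ → Config c} → Run H L → Patient G (family L H)
  Run⇒Patient L {H} run = walks , moves
    where
    moves : ∀ (i : Fin L) → Move (H (toℕ (inject₁ i))) (H (toℕ (fsuc i)))
    moves i rewrite toℕ-inject₁ i = run (toℕ i) (toℕ<n i)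
    walks : ∀ j → WeakWalk G (family L H j)
    walks j i with moves i
    ... | k , e , rest with j ≟ k
    ...   | yes refl = inj₂ e
    ...   | no j≢k   = inj₁ (rest j j≢k)

  module _ {c ℓ L : ℕ} (F : Family G c ℓ) {H : ℕ → Config c}
           (ℓ≤L : ℓ ≤ L) (H-extends-F : ∀ n → n ≤ ℓ → H n ≡ snapshot F n) where

    family-extends : ∀ k t → family L H k (clamp L (toℕ t)) ≡ F k t
    family-extends k t = begin
      H (toℕ (clamp L (toℕ t))) k ≡⟨ cong (λ n → H n k) (toℕ-clamp L (≤-trans t≤ℓ ℓ≤L)) ⟩
      H (toℕ t) k                 ≡⟨ cong (λ x → x k) (H-extends-F (toℕ t) t≤ℓ) ⟩
      F k (clamp ℓ (toℕ t))       ≡⟨ cong (F k) (clamp-toℕ ℓ t) ⟩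
      F k t                       ∎
      where
      open ≡-Reasoning
      t≤ℓ : toℕ t ≤ ℓ
      t≤ℓ = toℕ≤pred[n] t

    extension-distinct : DistinctMembers G F → DistinctMembers G (family L H)
    extension-distinct distinct a b a≢b with distinct a b a≢b
    ... | t , differ = clamp L (toℕ t) , λ same →
      differ (trans (sym (family-extends a t)) (trans same (family-extends b t)))

    extension-isPatientTour : Run H L → (∀ j → WeakTrack G (F j)) → PatientTour G (family L H)
    extension-isPatientTour run tracks = patient , λ k → proj₁ patient k , onto k
      where
      patient : Patient G (family L H)
      patient = Run⇒Patient L run
      onto : ∀ k v → Σ (Fin (suc L)) λ t → family L H k t ≡ v
      onto k v with proj₂ (tracks k) v
      ... | t , Fkt≡v = clamp L (toℕ t) , trans (family-extends k t) Fkt≡v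

  separated⇒MinDist : ∀ {c d} L {H : ℕ → Config c} → 2 ≤ c → (∀ n → n ≤ L → Separated d (H n)) →
                      ∀ i j → i ≢ j → PathLen G (H L i) (H L j) d → MinDist G (family L H) d
  separated⇒MinDist {d = d} L {H} two sep i j i≢j p =
    two
    , (λ a b a≢b t k dist → sep (toℕ t) (toℕ≤pred[n] t) a b a≢b (proj₁ dist))
    , i , j , i≢j , fromℕ L
    , subst (λ n → Dist G (H n i) (H n j) d) (sym (toℕ-fromℕ L))
        (p , λ k k<d q → <⇒≱ k<d (sep L ≤-refl i j i≢j q))

  module BacktrackAndSlide
      {c ℓ s d : ℕ} (F : Family G c ℓ) (patient : Patient G F)
      (bound : ∀ a b → a ≢ b → ∀ t k → Dist G (F a t) (F b t) k → s ≤ k)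
      {i j : Fin c} (i≢j : i ≢ j) (t₀ : Fin (suc ℓ)) (P : PathLen G (F i t₀) (F j t₀) s)
      (d≤s : d ≤ s) where

    x₀ : Config c
    x₀ k = F k t₀
    r e L : ℕ
    r = ℓ ∸ toℕ t₀
    e = s ∸ d
    L = ℓ + (r + e)
    backward : ℕ → Config c
    backward n = snapshot F (ℓ ∸ n)
    H : ℕ → Config c
    H = snapshot F ⟨ ℓ ⟩++ (backward ⟨ r ⟩++ slide x₀ i P)
    ℓ≤L : ℓ ≤ L
    ℓ≤L = m≤m+n ℓ (r + e)

    backward-reaches-t₀ : backward r ≗ slide x₀ i P 0
    backward-reaches-t₀ k = trans
      (cong (F k) (trans (cong (clamp ℓ) (m∸[m∸n]≡n (toℕ≤pred[n] t₀))) (clamp-toℕ ℓ t₀)))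
      (sym (slide-zero x₀ i P k))

    run : Run H L
    run = Run-++ ℓ (r + e) forward
            (Run-++ r e (Run-≤ (m∸n≤m ℓ (toℕ t₀)) (Run-reverse ℓ forward))
                    (Run-≤ (m∸n≤m s d) (slide-run x₀ i P)) backward-reaches-t₀)
            (λ _ → refl)
      where
      forward : Run (snapshot F) ℓ
      forward = Patient⇒Run F patient

    separatedAt : ∀ t → Separated s (λ k → F k t)
    separatedAt t a b a≢b = distBound⇒walkBound (bound a b a≢b t)

    d≤s∸m : ∀ {m} → m ≤ e → d ≤ s ∸ m
    d≤s∸m m≤e = subst (_≤ _) (m∸[m∸n]≡n d≤s) (∸-monoʳ-≤ s m≤e)

    separated : ∀ n → n ≤ L → Separated d (H n)
    separated = ++-all (Separated d) ℓ (r + e)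
      (λ n _ → Separated-mono d≤s (separatedAt (clamp ℓ n)))
      (++-all (Separated d) r e
        (λ n _ → Separated-mono d≤s (separatedAt (clamp ℓ (ℓ ∸ n))))
        (λ m m≤e → Separated-mono (d≤s∸m m≤e)
                     (slide-separated x₀ i P (≤-trans m≤e (m∸n≤m s d)) (separatedAt t₀))))

    H-ends-sliding : H L ≗ slide x₀ i P e
    H-ends-sliding k = trans (++-end ℓ (r + e) (λ _ → refl) k) (++-end r e backward-reaches-t₀ k)

    walk-at-end : PathLen G (H L i) (H L j) d
    walk-at-end = castʷ
      (sym (trans (H-ends-sliding i) (slide-moves x₀ i P e)))
      (sym (trans (H-ends-sliding j) (slide-stays x₀ i P e (i≢j ∘ sym))))
      (subst (PathLen G _ _) (m∸[m∸n]≡n d≤s) (suffix P e (m∸n≤m s d)))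

  CapAchieved-downClosed : ∀ {s d c} → d ≤ s → CapAchieved G s c → CapAchieved G d c
  CapAchieved-downClosed d≤s
      (ℓ , F , distinct , (patient , tracks) , (two , bound , i , j , i≢j , t₀ , (P , _))) =
    L , family L H
    , extension-distinct F ℓ≤L (++-prefix ℓ) distinct
    , extension-isPatientTour F ℓ≤L (++-prefix ℓ) run tracks
    , separated⇒MinDist L two separated i j i≢j walk-at-end
    where
    open BacktrackAndSlide F patient bound i≢j t₀ P d≤s

proposition3p8 : (G : Graph) → Connected G → NonTrivial G → ¬ IsPathGraph G →
    ∀ (s : ℕ) → IsVertexSpan G s → ∀ (c : ℕ) → IsCap G s c →
    2 ≤ c × (∀ (d : ℕ) → d ≤ s → Σ ℕ (λ c' → c ≤ c' × CapAchieved G d c'))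
proposition3p8 G _ _ _ s _ c (achieved@(_ , _ , _ , _ , two , _) , _) =
  two , λ d d≤s → c , ≤-refl , CapAchieved-downClosed G d≤s achieved
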